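{- Let $p,q\ge3$ with $(p-2)(q-2)>4$. Let $D=\lim_{k\to\infty}D_k$ and let $D(i)$ be its $i$-th letter, and let $B(i)=\lfloor (i+1)\beta\rfloor-\lfloor i\beta\rfloor-\lfloor\beta\rfloor$. Then $D(i)=B(i-1)$ for all $i\ge1$.
   Context: $\beta=\frac{(p-2)(q-2)+\sqrt{(p-2)^2(q-2)^2-4(p-2)(q-2)}}{2(p-2)}$. The Sturmian word of $\beta$ is the concatenation $B(1)B(2)\cdots$; the formula for $B(i)$ also makes sense for $i=0$ and gives $B(0)=0$. Words over $\{0,1\}$: $x^a$ means $a$ consecutive copies of $x$. Define words $C_k,D_k$ ($k\ge1$): if $p=3$ (so $q\ge7$): $C_1=1$, $D_1=0$, $C_{k+1}=D_kC_k^{q-5}$, $D_{k+1}=D_kC_k^{q-6}$; if $p\ge4,q\ge4$: $C_1=1$, $D_1=0$, $C_{k+1}=D_kC_k^{p-4}(D_kC_k^{p-3})^{q-3}$, $D_{k+1}=D_kC_k^{p-4}(D_kC_k^{p-3})^{q-4}$; if $q=3$ (so $p\ge7$): $C_1=1$, $D_1=01$, $C_{k+1}=D_kC_k^{p-5}$, $D_{k+1}=D_kC_k^{p-6}$. Each $D_k$ is a prefix of $D_{k+1}$, and $D$ is the limit infinite word. -}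

module Defs where

open import Data.Nat using (ℕ; zero; suc; _+_; _*_; _∸_; _≤ᵇ_; _/_)
open import Data.Bool using (if_then_else_)
open import Data.List using (List; []; _∷_; _++_)
open import Data.Product using (_×_; _,_; proj₁; proj₂)

isqrtFrom : ℕ → ℕ → ℕ
isqrtFrom N zero    = zero
isqrtFrom N (suc r) = if (suc r * suc r) ≤ᵇ N then suc r else isqrtFrom N r

isqrt : ℕ → ℕ
isqrt N = isqrtFrom N N

-- With a = (p-2)(q-2) and Δ = a² - 4a we have
--   β = (a + √Δ) / (2(p-2)),
-- so for i ∈ ℕ (p ≥ 3):
--   ⌊ i β ⌋ = ⌊ (i·a + i√Δ) / (2(p-2)) ⌋ = ⌊ (i·a + ⌊√(i²Δ)⌋) / (2(p-2)) ⌋.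
-- The denominator 2(p-2) is written as suc (suc (2 * (p ∸ 3))), which equals
-- 2(p-2) whenever p ≥ 3 (always assumed).
floorMulβ : ℕ → ℕ → ℕ → ℕ
floorMulβ p q i =
  (i * a + isqrt (i * i * (a * a ∸ 4 * a))) / suc (suc (2 * (p ∸ 3)))
  where
  a : ℕ
  a = (p ∸ 2) * (q ∸ 2)

B : ℕ → ℕ → ℕ → ℕ
B p q i = floorMulβ p q (suc i) ∸ floorMulβ p q i ∸ floorMulβ p q 1

-- Words over {0,1}, letters represented by the naturals 0 and 1.
Word : Set
Word = List ℕ

_^w_ : Word → ℕ → Word
x ^w zero  = []
x ^w suc a = x ++ (x ^w a)

-- The pair (C_k , D_k), indexed so that CD p q 0 = (C_1 , D_1).
CD : ℕ → ℕ → ℕ → Word × Word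
CD 3 q zero = (1 ∷ []) , (0 ∷ [])
CD 3 q (suc k) with CD 3 q k
... | C , D = (D ++ (C ^w (q ∸ 5))) , (D ++ (C ^w (q ∸ 6)))
CD p 3 zero = (1 ∷ []) , (0 ∷ 1 ∷ [])
CD p 3 (suc k) with CD p 3 k
... | C , D = (D ++ (C ^w (p ∸ 5))) , (D ++ (C ^w (p ∸ 6)))
CD p q zero = (1 ∷ []) , (0 ∷ [])
CD p q (suc k) with CD p q k
... | C , D =
  (D ++ (C ^w (p ∸ 4)) ++ ((D ++ (C ^w (p ∸ 3))) ^w (q ∸ 3))) ,
  (D ++ (C ^w (p ∸ 4)) ++ ((D ++ (C ^w (p ∸ 3))) ^w (q ∸ 4)))

-- C_k and D_k for k ≥ 1 (the value at k = 0 is unused).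
Cw : ℕ → ℕ → ℕ → Word
Cw p q k = proj₁ (CD p q (k ∸ 1))

Dw : ℕ → ℕ → ℕ → Word
Dw p q k = proj₂ (CD p q (k ∸ 1))

-- For p, q ≥ 4 put a = p − 4, b = q − 4. Then β = (q − 3) + γ(a, b), where γ(a, b) ∈ [0, 1) is
-- the positive root of (2 + a) γ² + (2 + a) b γ = a + b + a b, so B is the characteristic word
-- i ↦ ⌊(i + 1) γ⌋ − ⌊i γ⌋ of γ(a, b). These roots satisfy
-- γ(a, b) = (a + γ(b, a)) / (1 + a + γ(b, a)), and the Sturmian substitution
-- π c : 0 ↦ 0 1^c, 1 ↦ 0 1^(c+1) sends the characteristic word of γ to that of (c + γ) / (1 + c + γ).
-- Hence σ = π a ∘ π b fixes the characteristic word of γ(a, b). The recursion for (C_k, D_k)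
-- says precisely C_k = σ^(k−1)(1) and D_k = σ^(k−1)(0), so, as B(0) = 0, each D_k is a prefix of B.
-- For p = 3 the fractional part of β is γ(q − 6, q − 6), fixed by π (q − 6) alone; for q = 3,
-- β = 1 / (2 − γ(p − 6, p − 6)), whose characteristic word is the image of that of γ(p − 6, p − 6)
-- under τ : 0 ↦ 0 1, 1 ↦ 1.

module Submission where

open import Defs
open import Data.Nat hiding (_^_)
open import Data.Nat.Properties
open import Data.Nat.Tactic.RingSolver using (solve; solve-∀)
open import Data.Nat.DivMod using (m/n*n≤m; m*n/n≡m; /-monoˡ-≤)
open import Data.Bool using (true; false; T)
open import Data.List using ([]; _∷_; [_]; _++_; length; lookup; replicate; concatMap)
open import Data.List.Properties using (++-assoc; ++-identityʳ; concatMap-++; concatMap-pure; length-replicate)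
open import Data.Fin using (Fin; toℕ) renaming (zero to fzero; suc to fsuc)
open import Data.Product using (_×_; _,_; proj₂)
open import Data.Sum using (_⊎_; inj₁; inj₂)
open import Data.Unit using (⊤; tt)
open import Data.Empty using (⊥-elim)
open import Function.Base using (_∘_)
open import Function.Bundles using (_⇔_; mk⇔; module Equivalence)
open import Function.Properties.Equivalence using () renaming (trans to ⇔-trans; sym to ⇔-sym)
open import Relation.Nullary using (¬_; yes; no)
open import Relation.Binary.PropositionalEquality hiding ([_]; J)

open Equivalence using (to; from)

m∸n≤o⇒m≤n+o : ∀ m n {o} → m ∸ n ≤ o → m ≤ n + o
m∸n≤o⇒m≤n+o m n m∸n≤o = ≤-trans (m≤n+m∸n m n) (+-monoʳ-≤ n m∸n≤o)

1+n∸n≡1 : ∀ n → suc n ∸ n ≡ 1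
1+n∸n≡1 zero    = refl
1+n∸n≡1 (suc n) = 1+n∸n≡1 n

≤-rebalance : ∀ k .{{_ : NonZero k}} {P Q P′ Q′} → k * P + Q′ ≡ P′ + k * Q → P ≤ Q ⇔ P′ ≤ Q′
≤-rebalance k {P} {Q} {P′} {Q′} e = mk⇔
  (λ P≤Q → +-cancelʳ-≤ (k * Q) P′ Q′ (begin
    P′ + k * Q ≡⟨ e ⟨
    k * P + Q′ ≤⟨ +-monoˡ-≤ Q′ (*-monoʳ-≤ k P≤Q) ⟩
    k * Q + Q′ ≡⟨ +-comm (k * Q) Q′ ⟩
    Q′ + k * Q ∎))
  (λ P′≤Q′ → *-cancelˡ-≤ k (+-cancelʳ-≤ Q′ (k * P) (k * Q) (begin
    k * P + Q′ ≡⟨ e ⟩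
    P′ + k * Q ≤⟨ +-monoˡ-≤ (k * Q) P′≤Q′ ⟩
    Q′ + k * Q ≡⟨ +-comm Q′ (k * Q) ⟩
    k * Q + Q′ ∎)))
  where open ≤-Reasoning

Subst : Set
Subst = ℕ → Word

infixl 9 _⋆_
_⋆_ : Subst → Subst → Subst
(f ⋆ g) x = concatMap f (g x)

_⋆_^_ : Subst → Subst → ℕ → Subst
ψ ⋆ φ ^ zero  = ψ
ψ ⋆ φ ^ suc k = (ψ ⋆ φ ^ k) ⋆ φ

concatMap-⋆ : ∀ (f g : Subst) w → concatMap (f ⋆ g) w ≡ concatMap f (concatMap g w)
concatMap-⋆ f g []      = refl
concatMap-⋆ f g (x ∷ w) = begin
  concatMap f (g x) ++ concatMap (f ⋆ g) w         ≡⟨ cong (concatMap f (g x) ++_) (concatMap-⋆ f g w) ⟩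
  concatMap f (g x) ++ concatMap f (concatMap g w) ≡⟨ concatMap-++ f (g x) (concatMap g w) ⟨
  concatMap f (g x ++ concatMap g w)               ∎
  where open ≡-Reasoning

concatMap-replicate : ∀ (f : Subst) n x → concatMap f (replicate n x) ≡ f x ^w n
concatMap-replicate f zero    x = refl
concatMap-replicate f (suc n) x = cong (f x ++_) (concatMap-replicate f n x)

Spells : (ℕ → ℕ) → ℕ → Word → Set
Spells s o []      = ⊤
Spells s o (x ∷ w) = s o ≡ x × Spells s (suc o) w

module _ {s : ℕ → ℕ} where

  spells-++ : ∀ o u v → Spells s o u → Spells s (o + length u) v → Spells s o (u ++ v)
  spells-++ o []      v _        hv = subst (λ o′ → Spells s o′ v) (+-identityʳ o) hv
  spells-++ o (x ∷ u) v (e , hu) hv =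
    e , spells-++ (suc o) u v hu (subst (λ o′ → Spells s o′ v) (+-suc o (length u)) hv)

  spells-replicate : ∀ o n x → (∀ r → r < n → s (o + r) ≡ x) → Spells s o (replicate n x)
  spells-replicate o zero    x h = tt
  spells-replicate o (suc n) x h =
    subst (λ o′ → s o′ ≡ x) (+-identityʳ o) (h 0 z<s) ,
    spells-replicate (suc o) n x (λ r r<n → subst (λ o′ → s o′ ≡ x) (+-suc o r) (h (suc r) (s<s r<n)))

  spells-lookup : ∀ o w → Spells s o w → (j : Fin (length w)) → lookup w j ≡ s (o + toℕ j)
  spells-lookup o (x ∷ w) (e , h) fzero    = trans (sym e) (cong s (sym (+-identityʳ o)))
  spells-lookup o (x ∷ w) (e , h) (fsuc j) =
    trans (spells-lookup (suc o) w h j) (cong s (sym (+-suc o (toℕ j))))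

  spells-cong : ∀ {t} o w → (∀ i → s i ≡ t i) → Spells s o w → Spells t o w
  spells-cong o []      s≗t _       = tt
  spells-cong o (x ∷ w) s≗t (e , h) = trans (sym (s≗t o)) e , spells-cong (suc o) w s≗t h

spells-concatMap : ∀ (μ : Subst) {s t} (pos : ℕ → ℕ) →
  (∀ i → pos (suc i) ≡ pos i + length (μ (s i))) → (∀ i → Spells t (pos i) (μ (s i))) →
  ∀ o w → Spells s o w → Spells t (pos o) (concatMap μ w)
spells-concatMap μ {s} {t} pos pos-suc block o []      _       = tt
spells-concatMap μ {s} {t} pos pos-suc block o (x ∷ w) (e , h) =
  spells-++ (pos o) (μ x) (concatMap μ w) (subst (λ y → Spells t (pos o) (μ y)) e (block o))
    (subst (λ o′ → Spells t o′ (concatMap μ w)) (trans (pos-suc o) (cong (λ y → pos o + length (μ y)) e))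
      (spells-concatMap μ pos pos-suc block (suc o) w h))

-- μ (s) = t as infinite words
MapsPrefixes : Subst → (ℕ → ℕ) → (ℕ → ℕ) → Set
MapsPrefixes μ s t = ∀ w → Spells s 0 w → Spells t 0 (concatMap μ w)

mapsPrefixes-id : ∀ {s} → MapsPrefixes [_] s s
mapsPrefixes-id {s} w h = subst (Spells s 0) (sym (concatMap-pure w)) h

mapsPrefixes-⋆ : ∀ {f g : Subst} {s t u} →
  MapsPrefixes f t u → MapsPrefixes g s t → MapsPrefixes (f ⋆ g) s u
mapsPrefixes-⋆ {f} {g} {u = u} hf hg w h =
  subst (Spells u 0) (sym (concatMap-⋆ f g w)) (hf (concatMap g w) (hg w h))

mapsPrefixes-iterate : ∀ {ψ φ : Subst} {s t} → MapsPrefixes ψ s t → MapsPrefixes φ s s →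
  ∀ k → MapsPrefixes (ψ ⋆ φ ^ k) s t
mapsPrefixes-iterate hψ hφ zero    = hψ
mapsPrefixes-iterate hψ hφ (suc k) = mapsPrefixes-⋆ (mapsPrefixes-iterate hψ hφ k) hφ

spells-image : ∀ {μ : Subst} {s t x} → MapsPrefixes μ s t → s 0 ≡ x → Spells t 0 (μ x)
spells-image {μ} {t = t} {x} hμ e = subst (Spells t 0) (++-identityʳ (μ x)) (hμ [ x ] (e , tt))

Δ : (ℕ → ℕ) → ℕ → ℕ
Δ F i = F (suc i) ∸ F i

π : ℕ → Subst
π c x = 0 ∷ replicate (x + c) 1

-- If F x = ⌊x γ⌋, then F′-spec says F′ y = ⌊y (c + γ) / (1 + c + γ)⌋.
module _ (c : ℕ) {F F′ : ℕ → ℕ} (F-zero : F 0 ≡ 0) (F-mono : ∀ i → F i ≤ F (suc i))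
         (F′-spec : ∀ j y → j ≤ F′ y ⇔ suc c * j ∸ c * y ≤ F (y ∸ j)) where

  private
    V : ℕ → ℕ
    V i = c * i + F i

    start : ℕ → ℕ
    start i = V i + i

    V-zero : V 0 ≡ 0
    V-zero = cong₂ _+_ (*-zeroʳ c) F-zero

    V-suc : ∀ i → V (suc i) ≡ V i + (Δ F i + c)
    V-suc i = begin
      c * suc i + F (suc i)     ≡⟨ cong (c * suc i +_) (m+[n∸m]≡n (F-mono i)) ⟨
      c * suc i + (F i + Δ F i) ≡⟨ rearrange (F i) (Δ F i) ⟩
      V i + (Δ F i + c)         ∎
      where
      open ≡-Reasoning
      rearrange : ∀ f d → c * suc i + (f + d) ≡ c * i + f + (d + c)
      rearrange f d = solve (c ∷ i ∷ f ∷ d ∷ [])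

    V-mono : ∀ i → V i ≤ V (suc i)
    V-mono i = subst (V i ≤_) (sym (V-suc i)) (m≤m+n (V i) _)

    F′-on-block : ∀ i v → V i ≤ v → v ≤ V (suc i) → F′ (v + suc i) ≡ v
    F′-on-block i v V≤v v≤V = ≤-antisym (≮⇒≥ too-big) (from (F′-spec v (v + suc i)) fits)
      where
      open ≤-Reasoning
      fits : suc c * v ∸ c * (v + suc i) ≤ F (v + suc i ∸ v)
      fits = subst (λ z → suc c * v ∸ c * (v + suc i) ≤ F z) (sym (m+n∸m≡n v (suc i)))
        (m≤n+o⇒m∸n≤o (suc c * v) (c * (v + suc i)) (begin
          v + c * v                   ≤⟨ +-monoˡ-≤ (c * v) v≤V ⟩
          c * suc i + F (suc i) + c * v ≡⟨ rearrange (F (suc i)) ⟩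
          c * (v + suc i) + F (suc i) ∎))
        where
        rearrange : ∀ f → c * suc i + f + c * v ≡ c * (v + suc i) + f
        rearrange f = solve (c ∷ i ∷ v ∷ f ∷ [])
      too-big : ¬ (v < F′ (v + suc i))
      too-big v<F′ = n≮n v (begin-strict
        v          <⟨ +-cancelʳ-≤ (c * suc v) (suc v) (V i) (begin
          suc v + c * suc v           ≤⟨ m∸n≤o⇒m≤n+o _ (c * (v + suc i)) overshoot ⟩
          c * (v + suc i) + F i       ≡⟨ rearrange (F i) ⟩
          V i + c * suc v             ∎) ⟩
        V i        ≤⟨ V≤v ⟩
        v          ∎)
        where
        overshoot : suc c * suc v ∸ c * (v + suc i) ≤ F i
        overshoot = subst (λ z → suc c * suc v ∸ c * (v + suc i) ≤ F z)
          (trans (cong (_∸ suc v) (+-suc v i)) (m+n∸m≡n v i)) (to (F′-spec (suc v) (v + suc i)) v<F′)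
        rearrange : ∀ f → c * (v + suc i) + f ≡ c * i + f + c * suc v
        rearrange f = solve (c ∷ i ∷ v ∷ f ∷ [])

    F′-zero : F′ 0 ≡ 0
    F′-zero = n≤0⇒n≡0 (≮⇒≥ λ 0<F′0 →
      <⇒≱ (subst (λ z → 0 < suc c * 1 ∸ z) (sym (*-zeroʳ c)) z<s)
          (subst (_ ≤_) F-zero (to (F′-spec 1 0) 0<F′0)))

    F′-at-start : ∀ i → F′ (start i) ≡ V i
    F′-at-start zero    = trans (cong (λ z → F′ (z + 0)) V-zero) (trans F′-zero (sym V-zero))
    F′-at-start (suc i) = F′-on-block i (V (suc i)) (V-mono i) ≤-refl

    F′-after-start : ∀ i → F′ (suc (start i)) ≡ V i
    F′-after-start i = trans (cong F′ (sym (+-suc (V i) i))) (F′-on-block i (V i) ≤-refl (V-mono i))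

    start-suc : ∀ i → start (suc i) ≡ start i + length (π c (Δ F i))
    start-suc i = begin
      V (suc i) + suc i                 ≡⟨ cong (_+ suc i) (V-suc i) ⟩
      V i + (Δ F i + c) + suc i         ≡⟨ rearrange (V i) (Δ F i) ⟩
      start i + suc (Δ F i + c)         ≡⟨ cong (λ n → start i + suc n) (length-replicate (Δ F i + c)) ⟨
      start i + length (π c (Δ F i))    ∎
      where
      open ≡-Reasoning
      rearrange : ∀ v d → v + (d + c) + suc i ≡ v + i + suc (d + c)
      rearrange v d = solve (v ∷ d ∷ c ∷ i ∷ [])

    F′-in-block : ∀ i r → r ≤ Δ F i + c → F′ (suc (start i + r)) ≡ V i + r
    F′-in-block i r r≤n = trans (cong F′ (shift (V i)))
      (F′-on-block i (V i + r) (m≤m+n (V i) r) (begin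
        V i + r           ≤⟨ +-monoʳ-≤ (V i) r≤n ⟩
        V i + (Δ F i + c) ≡⟨ V-suc i ⟨
        V (suc i)         ∎))
      where
      open ≤-Reasoning
      shift : ∀ v → suc (v + i + r) ≡ v + r + suc i
      shift v = solve (v ∷ i ∷ r ∷ [])

    block : ∀ i → Spells (Δ F′) (start i) (π c (Δ F i))
    block i = opening , spells-replicate (suc (start i)) (Δ F i + c) 1 rising
      where
      open ≡-Reasoning
      opening : Δ F′ (start i) ≡ 0
      opening = trans (cong₂ _∸_ (F′-after-start i) (F′-at-start i)) (n∸n≡0 (V i))
      rising : ∀ r → r < Δ F i + c → Δ F′ (suc (start i) + r) ≡ 1
      rising r r<n = begin
        F′ (suc (suc (start i + r))) ∸ F′ (suc (start i + r))
          ≡⟨ cong₂ _∸_ (trans (cong (F′ ∘ suc) (sym (+-suc (start i) r))) (F′-in-block i (suc r) r<n))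
                       (F′-in-block i r (<⇒≤ r<n)) ⟩
        V i + suc r ∸ (V i + r) ≡⟨ [m+n]∸[m+o]≡n∸o (V i) (suc r) r ⟩
        suc r ∸ r               ≡⟨ 1+n∸n≡1 r ⟩
        1                       ∎

  π-maps-Δ : MapsPrefixes (π c) (Δ F) (Δ F′)
  π-maps-Δ w h = subst (λ o → Spells (Δ F′) o (concatMap (π c) w)) (cong (_+ 0) V-zero)
    (spells-concatMap (π c) start start-suc block 0 w h)

τ : Subst
τ zero    = 0 ∷ 1 ∷ []
τ (suc _) = 1 ∷ []

-- If F x = ⌊x γ⌋, then F′-spec says F′ y = ⌊y / (2 − γ)⌋.
module _ {F F′ : ℕ → ℕ} (F-zero : F 0 ≡ 0)
         (F-mono : ∀ i → F i ≤ F (suc i)) (F-step : ∀ i → F (suc i) ≤ suc (F i))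
         (F′-spec : ∀ j y → j ≤ F′ y ⇔ 2 * j ∸ y ≤ F j) where

  private
    F-≤ : ∀ v → F v ≤ v
    F-≤ zero    = ≤-reflexive F-zero
    F-≤ (suc v) = ≤-trans (F-step v) (s≤s (F-≤ v))

    start : ℕ → ℕ
    start v = v + (v ∸ F v)

    start+F : ∀ v → start v + F v ≡ 2 * v
    start+F v = begin
      v + (v ∸ F v) + F v   ≡⟨ +-assoc v (v ∸ F v) (F v) ⟩
      v + (v ∸ F v + F v)   ≡⟨ cong (v +_) (m∸n+n≡m (F-≤ v)) ⟩
      v + v                 ≡⟨ cong (v +_) (+-identityʳ v) ⟨
      2 * v                 ∎
      where open ≡-Reasoning

    F′-on-block : ∀ v y → start v ≤ y → y < start (suc v) → F′ y ≡ v
    F′-on-block v y start≤y y<start = ≤-antisym (≮⇒≥ too-big) (from (F′-spec v y) fits)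
      where
      fits : 2 * v ∸ y ≤ F v
      fits = m≤n+o⇒m∸n≤o (2 * v) y (subst (_≤ y + F v) (start+F v) (+-monoˡ-≤ (F v) start≤y))
      too-big : ¬ (v < F′ y)
      too-big v<F′ = <⇒≱ (subst (y + F (suc v) <_) (start+F (suc v)) (+-monoˡ-< (F (suc v)) y<start))
        (m∸n≤o⇒m≤n+o (2 * suc v) y (to (F′-spec (suc v) y) v<F′))

    data Step (v : ℕ) : Set where
      flat : Δ F v ≡ 0 → start (suc v) ≡ 2 + start v → Step v
      rise : Δ F v ≡ 1 → start (suc v) ≡ 1 + start v → Step v

    step : ∀ v → Step v
    step v with m≤n⇒m<n∨m≡n (F-step v)
    ... | inj₁ F<1+F = flat
      (trans (cong (_∸ F v) F-flat) (n∸n≡0 (F v)))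
      (begin
        suc v + (suc v ∸ F (suc v)) ≡⟨ cong (λ f → suc v + (suc v ∸ f)) F-flat ⟩
        suc v + (suc v ∸ F v)       ≡⟨ cong (suc v +_) (+-∸-assoc 1 (F-≤ v)) ⟩
        suc v + suc (v ∸ F v)       ≡⟨ cong suc (+-suc v (v ∸ F v)) ⟩
        2 + start v                 ∎)
      where
      open ≡-Reasoning
      F-flat : F (suc v) ≡ F v
      F-flat = ≤-antisym (s≤s⁻¹ F<1+F) (F-mono v)
    ... | inj₂ F≡1+F = rise
      (trans (cong (_∸ F v) F≡1+F) (1+n∸n≡1 (F v)))
      (cong (λ f → suc v + (suc v ∸ f)) F≡1+F)

    start-suc : ∀ v → start (suc v) ≡ start v + length (τ (Δ F v))
    start-suc v with step v
    ... | flat Δ≡0 e = trans e (trans (+-comm 2 (start v)) (cong (λ d → start v + length (τ d)) (sym Δ≡0)))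
    ... | rise Δ≡1 e = trans e (trans (+-comm 1 (start v)) (cong (λ d → start v + length (τ d)) (sym Δ≡1)))

    start-< : ∀ v → start v < start (suc v)
    start-< v with step v
    ... | flat _ e = subst (start v <_) (sym e) (m<n+m (start v) {2} z<s)
    ... | rise _ e = subst (start v <_) (sym e) (n<1+n (start v))

    F′-at-start : ∀ v → F′ (start v) ≡ v
    F′-at-start v = F′-on-block v (start v) ≤-refl (start-< v)

    block : ∀ v → Spells (Δ F′) (start v) (τ (Δ F v))
    block v with step v
    ... | flat Δ≡0 e = subst (λ d → Spells (Δ F′) (start v) (τ d)) (sym Δ≡0)
      ( trans (cong₂ _∸_ F′-middle (F′-at-start v)) (n∸n≡0 v)
      , trans (cong₂ _∸_ (trans (cong F′ (sym e)) (F′-at-start (suc v))) F′-middle) (1+n∸n≡1 v)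
      , tt)
      where
      F′-middle : F′ (suc (start v)) ≡ v
      F′-middle = F′-on-block v (suc (start v)) (n≤1+n (start v)) (subst (suc (start v) <_) (sym e) (n<1+n _))
    ... | rise Δ≡1 e = subst (λ d → Spells (Δ F′) (start v) (τ d)) (sym Δ≡1)
      ( trans (cong₂ _∸_ (trans (cong F′ (sym e)) (F′-at-start (suc v))) (F′-at-start v)) (1+n∸n≡1 v)
      , tt)

  τ-maps-Δ : MapsPrefixes τ (Δ F) (Δ F′)
  τ-maps-Δ w h = subst (λ o → Spells (Δ F′) o (concatMap τ w)) (cong (0 ∸_) F-zero)
    (spells-concatMap τ start start-suc block 0 w h)

-- LeRoot a b j x encodes j ≤ γ(a, b) x: the left-hand side increases with j.
LeRoot : ℕ → ℕ → ℕ → ℕ → Set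
LeRoot a b j x = (2 + a) * (j * j) + (2 + a) * b * (j * x) ≤ (a + b + a * b) * (x * x)

leRoot-zero : ∀ a b x → LeRoot a b 0 x
leRoot-zero a b x = subst (_≤ (a + b + a * b) * (x * x)) (sym (vanishes a b x)) z≤n
  where
  vanishes : ∀ a b x → (2 + a) * (0 * 0) + (2 + a) * b * (0 * x) ≡ 0
  vanishes = solve-∀

¬leRoot-≥ : ∀ a b {j x} → 1 ≤ j → x ≤ j → ¬ LeRoot a b j x
¬leRoot-≥ a b {suc j} {zero} _ _ h with ≤-trans h (≤-reflexive (*-zeroʳ (a + b + a * b)))
... | ()
¬leRoot-≥ a b {j} {suc x} _ x≤j h = <⇒≱ (begin-strict
  (a + b + a * b) * (suc x * suc x)                 <⟨ *-monoˡ-< (suc x * suc x) coefficients ⟩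
  ((2 + a) + (2 + a) * b) * (suc x * suc x)         ≡⟨ *-distribʳ-+ (suc x * suc x) (2 + a) ((2 + a) * b) ⟩
  (2 + a) * (suc x * suc x) + (2 + a) * b * (suc x * suc x)
    ≤⟨ +-mono-≤ (*-monoʳ-≤ (2 + a) (*-mono-≤ x≤j x≤j)) (*-monoʳ-≤ ((2 + a) * b) (*-monoˡ-≤ (suc x) x≤j)) ⟩
  (2 + a) * (j * j) + (2 + a) * b * (j * suc x)      ∎) h
  where
  open ≤-Reasoning
  coefficients : a + b + a * b < (2 + a) + (2 + a) * b
  coefficients = subst (a + b + a * b <_) (sym (split a b)) (m≤m+n _ (suc b))
    where
    split : ∀ a b → (2 + a) + (2 + a) * b ≡ suc (a + b + a * b) + suc b
    split = solve-∀

leRoot-ratio : ∀ a b e d j x .{{_ : NonZero d}} → LeRoot a b e d → d * j ≤ e * x → LeRoot a b j x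
leRoot-ratio a b e d j x h dj≤ex = *-cancelˡ-≤ (d * d) (begin
  d * d * ((2 + a) * (j * j) + (2 + a) * b * (j * x))
    ≡⟨ solve (d ∷ a ∷ b ∷ j ∷ x ∷ []) ⟩
  (2 + a) * ((d * j) * (d * j)) + (2 + a) * b * ((d * j) * (d * x))
    ≤⟨ +-mono-≤ (*-monoʳ-≤ (2 + a) (*-mono-≤ dj≤ex dj≤ex)) (*-monoʳ-≤ ((2 + a) * b) (*-monoˡ-≤ (d * x) dj≤ex)) ⟩
  (2 + a) * ((e * x) * (e * x)) + (2 + a) * b * ((e * x) * (d * x))
    ≡⟨ solve (d ∷ a ∷ b ∷ e ∷ x ∷ []) ⟩
  x * x * ((2 + a) * (e * e) + (2 + a) * b * (e * d))
    ≤⟨ *-monoʳ-≤ (x * x) h ⟩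
  x * x * ((a + b + a * b) * (d * d))
    ≡⟨ solve (d ∷ a ∷ b ∷ x ∷ []) ⟩
  d * d * ((a + b + a * b) * (x * x)) ∎)
  where
  open ≤-Reasoning
  instance _ = m*n≢0 d d

leRoot-a/[1+a] : ∀ a b → LeRoot a b a (suc a)
leRoot-a/[1+a] a b = ≤-trans (m≤m+n _ (a + b + a * b)) (≤-reflexive (sym (expand a b)))
  where
  expand : ∀ a b → (a + b + a * b) * (suc a * suc a)
                 ≡ (2 + a) * (a * a) + (2 + a) * b * (a * suc a) + (a + b + a * b)
  expand = solve-∀

leRoot-swap-core : ∀ a b X J → LeRoot a b (a * X + J) (suc a * X + J) ⇔ LeRoot b a J X
leRoot-swap-core a b X J = ≤-rebalance 1 (balance a b X J)
  where
  balance : ∀ a b X J →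
    1 * ((2 + a) * ((a * X + J) * (a * X + J)) + (2 + a) * b * ((a * X + J) * (suc a * X + J)))
      + (b + a + b * a) * (X * X)
    ≡ (2 + b) * (J * J) + (2 + b) * a * (J * X)
      + 1 * ((a + b + a * b) * ((suc a * X + J) * (suc a * X + J)))
  balance = solve-∀

swap-coordinates : ∀ a {j x} → j ≤ x → a * x < suc a * j →
  j ≡ a * (x ∸ j) + (suc a * j ∸ a * x) × x ≡ suc a * (x ∸ j) + (suc a * j ∸ a * x)
swap-coordinates a {j} {x} j≤x ax<j+aj = j≡ , x≡
  where
  X = x ∸ j
  J = suc a * j ∸ a * x
  x≡j+X : x ≡ j + X
  x≡j+X = sym (m+[n∸m]≡n j≤x)
  j≡ : j ≡ a * X + J
  j≡ = +-cancelˡ-≡ (a * j) j (a * X + J) (begin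
    a * j + j          ≡⟨ +-comm (a * j) j ⟩
    suc a * j          ≡⟨ m+[n∸m]≡n (<⇒≤ ax<j+aj) ⟨
    a * x + J          ≡⟨ cong (λ y → a * y + J) x≡j+X ⟩
    a * (j + X) + J    ≡⟨ distribute a j X J ⟩
    a * j + (a * X + J) ∎)
    where
    open ≡-Reasoning
    distribute : ∀ a j X J → a * (j + X) + J ≡ a * j + (a * X + J)
    distribute = solve-∀
  x≡ : x ≡ suc a * X + J
  x≡ = begin
    x                 ≡⟨ x≡j+X ⟩
    j + X             ≡⟨ cong (_+ X) j≡ ⟩
    a * X + J + X     ≡⟨ collect a X J ⟩
    suc a * X + J     ∎
    where
    open ≡-Reasoning
    collect : ∀ a X J → a * X + J + X ≡ suc a * X + J
    collect = solve-∀

-- γ(a, b) = (a + γ(b, a)) / (1 + a + γ(b, a)), stated for cuts.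
leRoot-swap : ∀ a b j x → LeRoot a b j x ⇔ LeRoot b a (suc a * j ∸ a * x) (x ∸ j)
leRoot-swap a b j x with j ≤? x
... | no j≰x = mk⇔
  (λ h → ⊥-elim (¬leRoot-≥ a b 1≤j (<⇒≤ x<j) h))
  (λ h → ⊥-elim (¬leRoot-≥ b a 1≤J z≤n (subst (LeRoot b a (suc a * j ∸ a * x)) (m≤n⇒m∸n≡0 (<⇒≤ x<j)) h)))
  where
  x<j = ≰⇒> j≰x
  1≤j : 1 ≤ j
  1≤j = ≤-trans (s≤s z≤n) x<j
  1≤J : 1 ≤ suc a * j ∸ a * x
  1≤J = m<n⇒0<n∸m (≤-trans (s≤s (*-monoʳ-≤ a (<⇒≤ x<j))) (+-monoˡ-≤ (a * j) 1≤j))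
... | yes j≤x with suc a * j ≤? a * x
...   | yes [1+a]j≤ax = mk⇔
  (λ _ → subst (λ J → LeRoot b a J (x ∸ j)) (sym (m≤n⇒m∸n≡0 [1+a]j≤ax)) (leRoot-zero b a (x ∸ j)))
  (λ _ → leRoot-ratio a b a (suc a) j x (leRoot-a/[1+a] a b) [1+a]j≤ax)
...   | no [1+a]j≰ax with swap-coordinates a j≤x (≰⇒> [1+a]j≰ax)
...     | j≡ , x≡ =
  subst₂ (λ j′ x′ → LeRoot a b j′ x′ ⇔ LeRoot b a (suc a * j ∸ a * x) (x ∸ j)) (sym j≡) (sym x≡)
         (leRoot-swap-core a b (x ∸ j) (suc a * j ∸ a * x))

IsFloor : (ℕ → ℕ → Set) → (ℕ → ℕ) → Set
IsFloor L G = ∀ j x → j ≤ G x ⇔ L j x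

module _ (a b : ℕ) {G : ℕ → ℕ} (G-floor : IsFloor (LeRoot a b) G) where

  private
    attained : ∀ x → LeRoot a b (G x) x
    attained x = to (G-floor (G x) x) ≤-refl

    vanishes-at : ∀ x → ¬ LeRoot a b 1 x → G x ≡ 0
    vanishes-at x ¬L = n≤0⇒n≡0 (≮⇒≥ λ 0<G → ¬L (to (G-floor 1 x) 0<G))

  floor-zero : G 0 ≡ 0
  floor-zero = vanishes-at 0 (¬leRoot-≥ a b ≤-refl z≤n)

  floor-one : G 1 ≡ 0
  floor-one = vanishes-at 1 (¬leRoot-≥ a b ≤-refl ≤-refl)

  floor-mono : ∀ i → G i ≤ G (suc i)
  floor-mono zero    = subst (_≤ G 1) (sym floor-zero) z≤n
  floor-mono (suc i) = from (G-floor (G (suc i)) (2 + i))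
    (leRoot-ratio a b (G (suc i)) (suc i) (G (suc i)) (2 + i) (attained (suc i)) (begin
      suc i * G (suc i)     ≡⟨ *-comm (suc i) (G (suc i)) ⟩
      G (suc i) * suc i     ≤⟨ *-monoʳ-≤ (G (suc i)) (n≤1+n (suc i)) ⟩
      G (suc i) * (2 + i)   ∎))
    where open ≤-Reasoning

  floor-Δ-zero : Δ G 0 ≡ 0
  floor-Δ-zero = cong₂ _∸_ floor-one floor-zero

  floor-step : ∀ i → G (suc i) ≤ suc (G i)
  floor-step i = below (G (suc i)) (attained (suc i))
    where
    below : ∀ u → LeRoot a b u (suc i) → u ≤ suc (G i)
    below zero     _ = z≤n
    below (suc u′) h = s≤s (from (G-floor u′ i)
      (leRoot-ratio a b (suc u′) (suc i) u′ i h (+-mono-≤ u′≤i (≤-reflexive (*-comm i u′)))))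
      where
      u′≤i : u′ ≤ i
      u′≤i = ≮⇒≥ λ i<u′ → ¬leRoot-≥ a b (s≤s z≤n) (m≤n⇒m≤1+n i<u′) h

π-maps-floor : ∀ a b {G G′ : ℕ → ℕ} → IsFloor (LeRoot b a) G → IsFloor (LeRoot a b) G′ →
  MapsPrefixes (π a) (Δ G) (Δ G′)
π-maps-floor a b G-floor G′-floor = π-maps-Δ a (floor-zero b a G-floor) (floor-mono b a G-floor)
  λ j y → ⇔-trans (G′-floor j y)
          (⇔-trans (leRoot-swap a b j y) (⇔-sym (G-floor (suc a * j ∸ a * y) (y ∸ j))))

isqrtFrom-sq≤ : ∀ N r → isqrtFrom N r * isqrtFrom N r ≤ N
isqrtFrom-sq≤ N zero    = z≤n
isqrtFrom-sq≤ N (suc r) with suc r * suc r ≤ᵇ N in eq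
... | true  = ≤ᵇ⇒≤ (suc r * suc r) N (subst T (sym eq) tt)
... | false = isqrtFrom-sq≤ N r

isqrtFrom-maximal : ∀ N r s → s ≤ r → s * s ≤ N → s ≤ isqrtFrom N r
isqrtFrom-maximal N zero    s s≤r _ = s≤r
isqrtFrom-maximal N (suc r) s s≤r s²≤N with suc r * suc r ≤ᵇ N in eq
... | true  = s≤r
... | false with m≤n⇒m<n∨m≡n s≤r
...   | inj₁ s<1+r = isqrtFrom-maximal N r s (s≤s⁻¹ s<1+r) s²≤N
...   | inj₂ refl  = ⊥-elim (subst T eq (≤⇒≤ᵇ s²≤N))

isqrt-floor : IsFloor (λ s N → s * s ≤ N) isqrt
isqrt-floor s N = mk⇔
  (λ s≤√N → ≤-trans (*-mono-≤ s≤√N s≤√N) (isqrtFrom-sq≤ N N))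
  (λ s²≤N → isqrtFrom-maximal N N s (≤-trans (m≤m*m s) s²≤N) s²≤N)
  where
  m≤m*m : ∀ s → s ≤ s * s
  m≤m*m zero    = z≤n
  m≤m*m (suc s) = m≤m*n (suc s) (suc s)

/-floor : ∀ d .{{_ : NonZero d}} → IsFloor (λ J N → J * d ≤ N) (_/ d)
/-floor d J N = mk⇔
  (λ J≤N/d → ≤-trans (*-monoˡ-≤ d J≤N/d) (m/n*n≤m N d))
  (λ Jd≤N → subst (_≤ N / d) (m*n/n≡m J d) (/-monoˡ-≤ d Jd≤N))

-- BelowBeta m n J x encodes J ≤ β x, where β is the larger root of m β² − m n β + n = 0:
-- either J lies below the midpoint m n x / 2 m of the roots, or between them.
BelowBeta : ℕ → ℕ → ℕ → ℕ → Set
BelowBeta m n J x = 2 * m * J ≤ m * n * x ⊎ m * (J * J) + n * (x * x) ≤ m * n * (J * x)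

module _ (m₀ n : ℕ) (4≤a : 4 ≤ suc m₀ * n) where

  private
    m = suc m₀
    a = m * n
    d = suc (suc (2 * m₀))

    √disc : ℕ → ℕ
    √disc x = isqrt (x * x * (a * a ∸ 4 * a))

    Jd≡2mJ : ∀ J → J * d ≡ 2 * m * J
    Jd≡2mJ J = double m₀ J
      where
      double : ∀ m₀ J → J * suc (suc (2 * m₀)) ≡ 2 * suc m₀ * J
      double = solve-∀

    -- Past the midpoint, write 2 m J = a x + R and square R ≤ √disc x.
    above-midpoint : ∀ J x R → 2 * m * J ≡ a * x + R →
      J * d ≤ x * a + √disc x ⇔ m * (J * J) + n * (x * x) ≤ a * (J * x)
    above-midpoint J x R 2mJ≡ =
      ⇔-trans (≤-rebalance 1 cancel-ax)
      (⇔-trans (isqrt-floor R _)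
      (⇔-trans (mk⇔ (m≤o∸n⇒m+n≤o (R * R) 4ax²≤a²x² ∘ subst (R * R ≤_) radicand)
                    (subst (R * R ≤_) (sym radicand) ∘ m+n≤o⇒m≤o∸n (R * R)))
               (⇔-sym (≤-rebalance (4 * m) complete-square))))
      where
      open ≡-Reasoning
      4ax²≤a²x² : x * x * (4 * a) ≤ x * x * (a * a)
      4ax²≤a²x² = *-monoʳ-≤ (x * x) (*-monoˡ-≤ a 4≤a)
      radicand : x * x * (a * a ∸ 4 * a) ≡ x * x * (a * a) ∸ x * x * (4 * a)
      radicand = *-distribˡ-∸ (x * x) (a * a) (4 * a)
      cancel-ax : 1 * (J * d) + √disc x ≡ R + 1 * (x * a + √disc x)
      cancel-ax = begin
        1 * (J * d) + √disc x       ≡⟨ cong (λ t → 1 * t + √disc x) (trans (Jd≡2mJ J) 2mJ≡) ⟩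
        1 * (a * x + R) + √disc x   ≡⟨ regroup a x R (√disc x) ⟩
        R + 1 * (x * a + √disc x)   ∎
        where
        regroup : ∀ a x R s → 1 * (a * x + R) + s ≡ R + 1 * (x * a + s)
        regroup = solve-∀
      complete-square : 4 * m * (m * (J * J) + n * (x * x)) + x * x * (a * a)
                      ≡ (R * R + x * x * (4 * a)) + 4 * m * (a * (J * x))
      complete-square = begin
        4 * m * (m * (J * J) + n * (x * x)) + x * x * (a * a)
          ≡⟨ scale m n J x ⟩
        (2 * m * J) * (2 * m * J) + x * x * (4 * a) + x * x * (a * a)
          ≡⟨ cong (λ w → w * w + x * x * (4 * a) + x * x * (a * a)) 2mJ≡ ⟩
        (a * x + R) * (a * x + R) + x * x * (4 * a) + x * x * (a * a)
          ≡⟨ expand a x R ⟩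
        (R * R + x * x * (4 * a)) + 2 * a * x * (a * x + R)
          ≡⟨ cong (λ w → (R * R + x * x * (4 * a)) + 2 * a * x * w) 2mJ≡ ⟨
        (R * R + x * x * (4 * a)) + 2 * a * x * (2 * m * J)
          ≡⟨ cong ((R * R + x * x * (4 * a)) +_) (regroup m n J x) ⟩
        (R * R + x * x * (4 * a)) + 4 * m * (a * (J * x)) ∎
        where
        scale : ∀ m n J x → 4 * m * (m * (J * J) + n * (x * x)) + x * x * (m * n * (m * n))
          ≡ (2 * m * J) * (2 * m * J) + x * x * (4 * (m * n)) + x * x * (m * n * (m * n))
        scale = solve-∀
        regroup : ∀ m n J x → 2 * (m * n) * x * (2 * m * J) ≡ 4 * m * (m * n * (J * x))
        regroup = solve-∀
        expand : ∀ a x R → (a * x + R) * (a * x + R) + x * x * (4 * a) + x * x * (a * a)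
                         ≡ (R * R + x * x * (4 * a)) + 2 * a * x * (a * x + R)
        expand = solve-∀

  floorMulβ-floor : IsFloor (BelowBeta m n) (floorMulβ (3 + m₀) (2 + n))
  floorMulβ-floor J x = ⇔-trans (/-floor d J (x * a + √disc x)) by-midpoint
    where
    by-midpoint : J * d ≤ x * a + √disc x ⇔ BelowBeta m n J x
    by-midpoint with 2 * m * J ≤? a * x
    ... | yes below = mk⇔ (λ _ → inj₁ below) λ _ → begin
      J * d         ≡⟨ Jd≡2mJ J ⟩
      2 * m * J     ≤⟨ below ⟩
      a * x         ≡⟨ *-comm a x ⟩
      x * a         ≤⟨ m≤m+n (x * a) (√disc x) ⟩
      x * a + √disc x  ∎
      where open ≤-Reasoning
    ... | no above = mk⇔ (inj₂ ∘ to between) (from between ∘ past-midpoint)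
      where
      between = above-midpoint J x (2 * m * J ∸ a * x) (sym (m+[n∸m]≡n (<⇒≤ (≰⇒> above))))
      past-midpoint : BelowBeta m n J x → m * (J * J) + n * (x * x) ≤ a * (J * x)
      past-midpoint (inj₁ below) = ⊥-elim (above below)
      past-midpoint (inj₂ h)     = h

module ShiftedFloor {L L′ : ℕ → ℕ → Set} {F : ℕ → ℕ} (c : ℕ) (F-floor : IsFloor L F)
                    (shift : ∀ j x → L (j + c * x) x ⇔ L′ j x) (L′-zero : ∀ x → L′ 0 x) where

  private
    cx≤F : ∀ x → c * x ≤ F x
    cx≤F x = from (F-floor (c * x) x) (from (shift 0 x) (L′-zero x))

  split : ∀ x → F x ≡ c * x + (F x ∸ c * x)
  split x = sym (m+[n∸m]≡n (cx≤F x))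

  isFloor : IsFloor L′ (λ x → F x ∸ c * x)
  isFloor j x = ⇔-trans (mk⇔ (m≤o∸n⇒m+n≤o j (cx≤F x)) (m+n≤o⇒m≤o∸n j))
                        (⇔-trans (F-floor (j + c * x) x) (shift j x))

B≡Δ : ∀ p q c {G : ℕ → ℕ} → (∀ x → floorMulβ p q x ≡ c * x + G x) → G 1 ≡ 0 → ∀ i → B p q i ≡ Δ G i
B≡Δ p q c {G} F≡ G-one i = begin
  F (suc i) ∸ F i ∸ F 1
    ≡⟨ ∸-+-assoc (F (suc i)) (F i) (F 1) ⟩
  F (suc i) ∸ (F i + F 1)
    ≡⟨ cong₂ _∸_ (F≡ (suc i)) (cong₂ _+_ (F≡ i) (F≡ 1)) ⟩
  c * suc i + G (suc i) ∸ (c * i + G i + (c * 1 + G 1))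
    ≡⟨ cong (λ g → c * suc i + G (suc i) ∸ g) (regroup c i (G i) (G 1) G-one) ⟩
  c * suc i + G (suc i) ∸ (c * suc i + G i)
    ≡⟨ [m+n]∸[m+o]≡n∸o (c * suc i) (G (suc i)) (G i) ⟩
  G (suc i) ∸ G i
    ∎
  where
  open ≡-Reasoning
  F = floorMulβ p q
  regroup : ∀ c i g g₁ → g₁ ≡ 0 → c * i + g + (c * 1 + g₁) ≡ c * suc i + g
  regroup c i g .0 refl = solve (c ∷ i ∷ g ∷ [])

belowBeta⇔leRoot : ∀ a b j x → BelowBeta (2 + a) (2 + b) (j + suc b * x) x ⇔ LeRoot a b j x
belowBeta⇔leRoot a b j x = mk⇔ to-leRoot (inj₂ ∘ from quadratic)
  where
  quadratic = ≤-rebalance 1 (balance a b j x)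
    where
    balance : ∀ a b j x →
      1 * ((2 + a) * ((j + suc b * x) * (j + suc b * x)) + (2 + b) * (x * x)) + (a + b + a * b) * (x * x)
      ≡ (2 + a) * (j * j) + (2 + a) * b * (j * x) + 1 * ((2 + a) * (2 + b) * ((j + suc b * x) * x))
    balance = solve-∀
  zero-numerator : ∀ j → 2 * (2 + a) * j + (2 + a) * b * x ≤ 0 → LeRoot a b j x
  zero-numerator zero    _ = leRoot-zero a b x
  zero-numerator (suc j) ()
  to-leRoot : BelowBeta (2 + a) (2 + b) (j + suc b * x) x → LeRoot a b j x
  to-leRoot (inj₁ below) = zero-numerator j (+-cancelʳ-≤ ((2 + a) * (2 + b) * x) _ 0
    (subst (_≤ (2 + a) * (2 + b) * x) (split a b j x) below))
    where
    split : ∀ a b j x →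
      2 * (2 + a) * (j + suc b * x) ≡ 2 * (2 + a) * j + (2 + a) * b * x + (2 + a) * (2 + b) * x
    split = solve-∀
  to-leRoot (inj₂ between) = to quadratic between

belowBeta⇔leRoot-p3 : ∀ e j x → BelowBeta 1 (5 + e) (j + (3 + e) * x) x ⇔ LeRoot (1 + e) (1 + e) j x
belowBeta⇔leRoot-p3 e j x = mk⇔ to-leRoot (inj₂ ∘ from quadratic)
  where
  quadratic = ≤-rebalance (3 + e) (balance e j x)
    where
    balance : ∀ e j x →
      (3 + e) * (1 * ((j + (3 + e) * x) * (j + (3 + e) * x)) + (5 + e) * (x * x))
        + (1 + e + (1 + e) + (1 + e) * (1 + e)) * (x * x)
      ≡ (3 + e) * (j * j) + (3 + e) * (1 + e) * (j * x) + (3 + e) * (1 * (5 + e) * ((j + (3 + e) * x) * x))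
    balance = solve-∀
  zero-numerator : ∀ j → 2 * j + (1 + e) * x ≤ 0 → LeRoot (1 + e) (1 + e) j x
  zero-numerator zero    _ = leRoot-zero (1 + e) (1 + e) x
  zero-numerator (suc j) ()
  to-leRoot : BelowBeta 1 (5 + e) (j + (3 + e) * x) x → LeRoot (1 + e) (1 + e) j x
  to-leRoot (inj₁ below) = zero-numerator j (+-cancelʳ-≤ (1 * (5 + e) * x) _ 0
    (subst (_≤ 1 * (5 + e) * x) (split e j x) below))
    where
    split : ∀ e j x → 2 * 1 * (j + (3 + e) * x) ≡ 2 * j + (1 + e) * x + 1 * (5 + e) * x
    split = solve-∀
  to-leRoot (inj₂ between) = to quadratic between

belowBeta⇔leRoot-q3 : ∀ e j y → BelowBeta (5 + e) 1 j y ⇔ LeRoot (1 + e) (1 + e) (2 * j ∸ y) j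
belowBeta⇔leRoot-q3 e j y with 2 * j ≤? y
... | yes 2j≤y = mk⇔
  (λ _ → subst (λ u → LeRoot (1 + e) (1 + e) u j) (sym (m≤n⇒m∸n≡0 2j≤y)) (leRoot-zero (1 + e) (1 + e) j))
  (λ _ → inj₁ (begin
    2 * (5 + e) * j   ≡⟨ solve (e ∷ j ∷ []) ⟩
    (5 + e) * (2 * j) ≤⟨ *-monoʳ-≤ (5 + e) 2j≤y ⟩
    (5 + e) * y       ≡⟨ solve (e ∷ y ∷ []) ⟩
    (5 + e) * 1 * y   ∎))
  where open ≤-Reasoning
... | no 2j≰y = mk⇔ to-leRoot (inj₂ ∘ from quadratic)
  where
  u = 2 * j ∸ y
  -- The identity is quadratic in j, y, u subject to y + u = 2 j; it is checked after
  -- multiplying by 4, where j only occurs through 2 j.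
  balance : ∀ j y u → y + u ≡ 2 * j →
    (3 + e) * ((5 + e) * (j * j) + 1 * (y * y)) + (1 + e + (1 + e) + (1 + e) * (1 + e)) * (j * j)
    ≡ (3 + e) * (u * u) + (3 + e) * (1 + e) * (u * j) + (3 + e) * ((5 + e) * 1 * (j * y))
  balance j y u y+u≡2j = *-cancelˡ-≡ _ _ 4 (begin
    4 * ((3 + e) * ((5 + e) * (j * j) + 1 * (y * y)) + (1 + e + (1 + e) + (1 + e) * (1 + e)) * (j * j))
      ≡⟨ solve (e ∷ j ∷ y ∷ []) ⟩
    (3 + e) * ((6 + 2 * e) * ((2 * j) * (2 * j)) + 4 * (y * y))
      ≡⟨ cong (λ w → (3 + e) * ((6 + 2 * e) * (w * w) + 4 * (y * y))) y+u≡2j ⟨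
    (3 + e) * ((6 + 2 * e) * ((y + u) * (y + u)) + 4 * (y * y))
      ≡⟨ solve (e ∷ y ∷ u ∷ []) ⟩
    (3 + e) * (4 * (u * u) + 2 * (1 + e) * (u * (y + u)) + 2 * (5 + e) * (y * (y + u)))
      ≡⟨ cong (λ w → (3 + e) * (4 * (u * u) + 2 * (1 + e) * (u * w) + 2 * (5 + e) * (y * w))) y+u≡2j ⟩
    (3 + e) * (4 * (u * u) + 2 * (1 + e) * (u * (2 * j)) + 2 * (5 + e) * (y * (2 * j)))
      ≡⟨ solve (e ∷ j ∷ y ∷ u ∷ []) ⟩
    4 * ((3 + e) * (u * u) + (3 + e) * (1 + e) * (u * j) + (3 + e) * ((5 + e) * 1 * (j * y))) ∎)
    where open ≡-Reasoning
  quadratic = ≤-rebalance (3 + e) (balance j y u (m+[n∸m]≡n (<⇒≤ (≰⇒> 2j≰y))))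
  to-leRoot : BelowBeta (5 + e) 1 j y → LeRoot (1 + e) (1 + e) u j
  to-leRoot (inj₁ below) = ⊥-elim (2j≰y (*-cancelˡ-≤ (5 + e) (begin
    (5 + e) * (2 * j) ≡⟨ solve (e ∷ j ∷ []) ⟩
    2 * (5 + e) * j   ≤⟨ below ⟩
    (5 + e) * 1 * y   ≡⟨ solve (e ∷ y ∷ []) ⟩
    (5 + e) * y       ∎)))
    where open ≤-Reasoning
  to-leRoot (inj₂ between) = to quadratic between

concatMap-π : ∀ (f : Subst) c x → concatMap f (π c x) ≡ f 0 ++ (f 1 ^w (x + c))
concatMap-π f c x = cong (f 0 ++_) (concatMap-replicate f (x + c) 1)

σ : ℕ → ℕ → Subst
σ a b = π a ⋆ π b

concatMap-σ : ∀ (f : Subst) a b x →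
  concatMap f (σ a b x) ≡ f 0 ++ (f 1 ^w a) ++ ((f 0 ++ (f 1 ^w suc a)) ^w (x + b))
concatMap-σ f a b x = begin
  concatMap f (concatMap (π a) (π b x))
    ≡⟨ concatMap-⋆ f (π a) (π b x) ⟨
  concatMap (f ⋆ π a) (π b x)
    ≡⟨ concatMap-π (f ⋆ π a) b x ⟩
  concatMap f (π a 0) ++ (concatMap f (π a 1) ^w (x + b))
    ≡⟨ cong₂ (λ u v → u ++ (v ^w (x + b))) (concatMap-π f a 0) (concatMap-π f a 1) ⟩
  (f 0 ++ (f 1 ^w a)) ++ ((f 0 ++ (f 1 ^w suc a)) ^w (x + b))
    ≡⟨ ++-assoc (f 0) (f 1 ^w a) _ ⟩
  f 0 ++ (f 1 ^w a) ++ ((f 0 ++ (f 1 ^w suc a)) ^w (x + b))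
    ∎
  where open ≡-Reasoning

CD-p,q≥4 : ∀ a b k → CD (4 + a) (4 + b) k ≡ (([_] ⋆ σ a b ^ k) 1 , ([_] ⋆ σ a b ^ k) 0)
CD-p,q≥4 a b zero = refl
CD-p,q≥4 a b (suc k) rewrite CD-p,q≥4 a b k =
  cong₂ _,_ (sym (concatMap-σ ([_] ⋆ σ a b ^ k) a b 1))
            (sym (concatMap-σ ([_] ⋆ σ a b ^ k) a b 0))

CD-p≡3 : ∀ e k → CD 3 (7 + e) k ≡ (([_] ⋆ π (1 + e) ^ k) 1 , ([_] ⋆ π (1 + e) ^ k) 0)
CD-p≡3 e zero = refl
CD-p≡3 e (suc k) rewrite CD-p≡3 e k =
  cong₂ _,_ (sym (concatMap-π ([_] ⋆ π (1 + e) ^ k) (1 + e) 1))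
            (sym (concatMap-π ([_] ⋆ π (1 + e) ^ k) (1 + e) 0))

CD-q≡3 : ∀ e k → CD (7 + e) 3 k ≡ ((τ ⋆ π (1 + e) ^ k) 1 , (τ ⋆ π (1 + e) ^ k) 0)
CD-q≡3 e zero = refl
CD-q≡3 e (suc k) rewrite CD-q≡3 e k =
  cong₂ _,_ (sym (concatMap-π (τ ⋆ π (1 + e) ^ k) (1 + e) 1))
            (sym (concatMap-π (τ ⋆ π (1 + e) ^ k) (1 + e) 0))

spells-Dw : ∀ p q {ψ φ : Subst} {s t} →
  (∀ k → proj₂ (CD p q k) ≡ (ψ ⋆ φ ^ k) 0) → (∀ i → B p q i ≡ t i) →
  MapsPrefixes ψ s t → MapsPrefixes φ s s → s 0 ≡ 0 → ∀ k → Spells (B p q) 0 (Dw p q (suc k))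
spells-Dw p q D≡ B≡t ψ-maps φ-maps s-zero k = subst (Spells (B p q) 0) (sym (D≡ k))
  (spells-cong 0 _ (sym ∘ B≡t) (spells-image (mapsPrefixes-iterate ψ-maps φ-maps k) s-zero))

module _ (a b : ℕ) where

  private
    module S = ShiftedFloor (suc b) (floorMulβ-floor (suc a) (2 + b) (*-mono-≤ (m≤m+n 2 a) (m≤m+n 2 b)))
                            (belowBeta⇔leRoot a b) (leRoot-zero a b)

  floorγ : ℕ → ℕ
  floorγ x = floorMulβ (4 + a) (4 + b) x ∸ suc b * x

  floorγ-floor : IsFloor (LeRoot a b) floorγ
  floorγ-floor = S.isFloor

  B-p,q≥4 : ∀ i → B (4 + a) (4 + b) i ≡ Δ floorγ i
  B-p,q≥4 = B≡Δ (4 + a) (4 + b) (suc b) S.split (floor-one a b floorγ-floor)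

σ-fixes : ∀ a b → MapsPrefixes (σ a b) (Δ (floorγ a b)) (Δ (floorγ a b))
σ-fixes a b = mapsPrefixes-⋆ (π-maps-floor a b (floorγ-floor b a) (floorγ-floor a b))
                             (π-maps-floor b a (floorγ-floor a b) (floorγ-floor b a))

module _ (e : ℕ) where

  private
    a = 1 + e
    module S = ShiftedFloor (3 + e) (floorMulβ-floor 0 (5 + e) (s≤s (s≤s (s≤s (s≤s z≤n)))))
                            (belowBeta⇔leRoot-p3 e) (leRoot-zero a a)

  floorγ-p≡3 : ℕ → ℕ
  floorγ-p≡3 x = floorMulβ 3 (7 + e) x ∸ (3 + e) * x

  floorγ-p≡3-floor : IsFloor (LeRoot a a) floorγ-p≡3
  floorγ-p≡3-floor = S.isFloor

  B-p≡3 : ∀ i → B 3 (7 + e) i ≡ Δ floorγ-p≡3 i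
  B-p≡3 = B≡Δ 3 (7 + e) (3 + e) S.split (floor-one a a floorγ-p≡3-floor)

module _ (e : ℕ) where

  private
    a = 1 + e
    F = floorMulβ (7 + e) 3

  floorMulβ-q≡3-spec : ∀ j y → j ≤ F y ⇔ 2 * j ∸ y ≤ floorγ a a j
  floorMulβ-q≡3-spec j y =
    ⇔-trans (floorMulβ-floor (4 + e) 1 (s≤s (s≤s (s≤s (s≤s z≤n)))) j y)
    (⇔-trans (belowBeta⇔leRoot-q3 e j y) (⇔-sym (floorγ-floor a a (2 * j ∸ y) j)))

  τ-maps-q≡3 : MapsPrefixes τ (Δ (floorγ a a)) (Δ F)
  τ-maps-q≡3 = τ-maps-Δ (floor-zero a a (floorγ-floor a a)) (floor-mono a a (floorγ-floor a a))
                        (floor-step a a (floorγ-floor a a)) floorMulβ-q≡3-spec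

  B-q≡3 : ∀ i → B (7 + e) 3 i ≡ Δ F i
  B-q≡3 = B≡Δ (7 + e) 3 0 (λ _ → refl) F-one
    where
    F-one : F 1 ≡ 0
    F-one = n≤0⇒n≡0 (≮⇒≥ λ 0<F1 →
      <⇒≱ z<s (subst (1 ≤_) (floor-one a a (floorγ-floor a a)) (to (floorMulβ-q≡3-spec 1 1) 0<F1)))

data Shape : ℕ → ℕ → Set where
  p≡3   : ∀ e → Shape 3 (7 + e)
  p,q≥4 : ∀ a b → Shape (4 + a) (4 + b)
  q≡3   : ∀ e → Shape (7 + e) 3

shape : ∀ p q → 3 ≤ p → 3 ≤ q → 4 < (p ∸ 2) * (q ∸ 2) → Shape p q
shape 0 _ () _ _
shape 1 _ (s≤s ()) _ _
shape 2 _ (s≤s (s≤s ())) _ _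
shape (suc (suc (suc _))) 0 _ () _
shape (suc (suc (suc _))) 1 _ (s≤s ()) _
shape (suc (suc (suc _))) 2 _ (s≤s (s≤s ())) _
shape 3 3 _ _ (s≤s ())
shape 3 4 _ _ (s≤s (s≤s ()))
shape 3 5 _ _ (s≤s (s≤s (s≤s ())))
shape 3 6 _ _ (s≤s (s≤s (s≤s (s≤s ()))))
shape 4 3 _ _ (s≤s (s≤s ()))
shape 5 3 _ _ (s≤s (s≤s (s≤s ())))
shape 6 3 _ _ (s≤s (s≤s (s≤s (s≤s ()))))
shape 3 (suc (suc (suc (suc (suc (suc (suc e))))))) _ _ _ = p≡3 e
shape (suc (suc (suc (suc (suc (suc (suc e))))))) 3 _ _ _ = q≡3 e
shape (suc (suc (suc (suc a)))) (suc (suc (suc (suc b)))) _ _ _ = p,q≥4 a b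

B-spells-Dw : ∀ {p q} → Shape p q → ∀ k → Spells (B p q) 0 (Dw p q (suc k))
B-spells-Dw (p≡3 e) = spells-Dw 3 (7 + e) (cong proj₂ ∘ CD-p≡3 e) (B-p≡3 e) mapsPrefixes-id
  (π-maps-floor (1 + e) (1 + e) (floorγ-p≡3-floor e) (floorγ-p≡3-floor e))
  (floor-Δ-zero (1 + e) (1 + e) (floorγ-p≡3-floor e))
B-spells-Dw (p,q≥4 a b) = spells-Dw (4 + a) (4 + b) (cong proj₂ ∘ CD-p,q≥4 a b) (B-p,q≥4 a b)
  mapsPrefixes-id (σ-fixes a b) (floor-Δ-zero a b (floorγ-floor a b))
B-spells-Dw (q≡3 e) = spells-Dw (7 + e) 3 (cong proj₂ ∘ CD-q≡3 e) (B-q≡3 e) (τ-maps-q≡3 e)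
  (π-maps-floor (1 + e) (1 + e) (floorγ-floor (1 + e) (1 + e)) (floorγ-floor (1 + e) (1 + e)))
  (floor-Δ-zero (1 + e) (1 + e) (floorγ-floor (1 + e) (1 + e)))

lemma4p3 : (p q : ℕ) → 3 ≤ p → 3 ≤ q → 4 < (p ∸ 2) * (q ∸ 2) →
    (k : ℕ) → 1 ≤ k → (j : Fin (length (Dw p q k))) →
    lookup (Dw p q k) j ≡ B p q (toℕ j)
lemma4p3 p q 3≤p 3≤q 4<pq (suc k) _ j =
  spells-lookup 0 (Dw p q (suc k)) (B-spells-Dw (shape p q 3≤p 3≤q 4<pq) k) j
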